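{- For formal parameters $\alpha,\beta$ let $$G^{(\alpha,\beta)}(x,y)=\sum_{T}\frac{x^{|\mathrm{LV}(T)|}\,y^{|\mathrm{RV}(T)|}\,\alpha^{\mathrm{LO}(T)}\,\beta^{\mathrm{RO}(T)}}{|\mathrm{LV}(T)|!\,|\mathrm{RV}(T)|!},$$ the sum running over all non-empty non-ambiguous trees $T$. Then $$G^{(\alpha,\beta)}=\Big(1+\alpha\int_0^x G^{(\alpha,1)}\Big)\cdot\Big(1+\beta\int_0^y G^{(1,\beta)}\Big),$$ where $\int_0^x$, $\int_0^y$ denote formal integration in $x$, $y$ with zero constant term.
   Context: A binary tree is a rooted tree in which each vertex has either no child, a left child, a right child, or both. $\mathrm{LV}(B)$ (resp. $\mathrm{RV}(B)$) is the set of left (resp. right) children of $B$; the root is in neither. A non-ambiguous tree (NAT) is a non-empty binary tree $B$ with a labelling of its left children bijectively by $1,\dots,|\mathrm{LV}(B)|$ and of its right children bijectively by $1,\dots,|\mathrm{RV}(B)|$, such that whenever $U,V$ are both left children (resp. both right children) and $U$ is a proper ancestor of $V$, the label of $U$ exceeds that of $V$. For a NAT $T$, $\mathrm{LO}(T)$ is the number of vertices on the leftmost branch of the root (the maximal chain $v_1,v_2,\dots$ where $v_1$ is the left child of the root and $v_{j+1}$ is the left child of $v_j$), and $\mathrm{RO}(T)$ is the number of vertices on the rightmost branch of the root (defined symmetrically with right children). -}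

module Defs where

open import Data.Bool using (Bool; true; false; _∧_; T)
open import Data.Nat using (ℕ; zero; suc; _≡ᵇ_; _<ᵇ_; _!)
open import Data.Nat.Properties using (_!*_!≢0)
open import Data.Maybe using (Maybe; just; nothing)
open import Data.Product using (Σ; _×_; _,_)
open import Data.List using (List; []; _∷_; _++_; length)
open import Data.Bool.ListAction using (all; any)
open import Data.Fin using (Fin)
open import Data.Integer using (+_)
open import Data.Rational using (ℚ; 0ℚ; 1ℚ; _+_; _*_; _/_)
open import Function.Bundles using (_↔_)

-- Binary trees whose non-root vertices carry a natural-number label.
-- node l r : l is the (optional) left child, given as (label , subtree
-- rooted at that child); similarly r for the right child.  The root
-- carries no label.  Whether a vertex is a left or right child is
-- determined by its position.

data LTree : Set where
  node : Maybe (ℕ × LTree) → Maybe (ℕ × LTree) → LTree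

mutual
  leftLabels : LTree → List ℕ
  leftLabels (node l r) = leftL l ++ leftR r

  leftL : Maybe (ℕ × LTree) → List ℕ
  leftL nothing = []
  leftL (just (k , s)) = k ∷ leftLabels s

  leftR : Maybe (ℕ × LTree) → List ℕ
  leftR nothing = []
  leftR (just (k , s)) = leftLabels s

mutual
  rightLabels : LTree → List ℕ
  rightLabels (node l r) = rightL l ++ rightR r

  rightL : Maybe (ℕ × LTree) → List ℕ
  rightL nothing = []
  rightL (just (k , s)) = rightLabels s

  rightR : Maybe (ℕ × LTree) → List ℕ
  rightR nothing = []
  rightR (just (k , s)) = k ∷ rightLabels s

nLV : LTree → ℕ
nLV t = length (leftLabels t)

nRV : LTree → ℕ
nRV t = length (rightLabels t)

LO : LTree → ℕ
LO (node nothing r) = zero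
LO (node (just (k , s)) r) = suc (LO s)

RO : LTree → ℕ
RO (node l nothing) = zero
RO (node l (just (k , s))) = suc (RO s)

-- Boolean checks (Bool-valued so that the predicates are propositions).
elemᵇ : ℕ → List ℕ → Bool
elemᵇ k xs = any (λ x → k ≡ᵇ x) xs

distinctᵇ : List ℕ → Bool
distinctᵇ [] = true
distinctᵇ (x ∷ xs) = (Data.Bool.not (elemᵇ x xs)) ∧ distinctᵇ xs
  where import Data.Bool

isLabelling : List ℕ → Bool
isLabelling xs = distinctᵇ xs ∧ all (λ x → (0 <ᵇ x) ∧ (x <ᵇ suc (length xs))) xs

mutual
  ancestorOK : LTree → Bool
  ancestorOK (node l r) = ancL l ∧ ancR r

  ancL : Maybe (ℕ × LTree) → Bool
  ancL nothing = true
  ancL (just (k , s)) = all (λ x → x <ᵇ k) (leftLabels s) ∧ ancestorOK s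

  ancR : Maybe (ℕ × LTree) → Bool
  ancR nothing = true
  ancR (just (k , s)) = all (λ x → x <ᵇ k) (rightLabels s) ∧ ancestorOK s

isNAT : LTree → Bool
isNAT t = isLabelling (leftLabels t) ∧ isLabelling (rightLabels t) ∧ ancestorOK t

matches : Maybe ℕ → ℕ → Bool
matches nothing v = true
matches (just a) v = a ≡ᵇ v

selNAT : ℕ → ℕ → Maybe ℕ → Maybe ℕ → LTree → Bool
selNAT m n a b t =
  isNAT t ∧ (m ≡ᵇ nLV t) ∧ (n ≡ᵇ nRV t) ∧ matches a (LO t) ∧ matches b (RO t)

NATset : ℕ → ℕ → Maybe ℕ → Maybe ℕ → Set
NATset m n a b = Σ LTree (λ t → T (selNAT m n a b t))

IsCount : (ℕ → ℕ → Maybe ℕ → Maybe ℕ → ℕ) → Set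
IsCount c = ∀ m n a b → Fin (c m n a b) ↔ NATset m n a b

-- Formal power series in x, y, α, β with rational coefficients:
-- f m n a b is the coefficient of x^m y^n α^a β^b.

PS : Set
PS = ℕ → ℕ → ℕ → ℕ → ℚ

sumTo : ℕ → (ℕ → ℚ) → ℚ
sumTo zero f = f zero
sumTo (suc n) f = sumTo n f + f (suc n)

_-_ : ℕ → ℕ → ℕ
m - zero = m
zero - suc n = zero
suc m - suc n = m - n

oneS : PS
oneS zero zero zero zero = 1ℚ
oneS _ _ _ _ = 0ℚ

_⊕_ : PS → PS → PS
(f ⊕ g) m n a b = f m n a b + g m n a b

_⊗_ : PS → PS → PS
(f ⊗ g) m n a b =
  sumTo m λ i → sumTo n λ j → sumTo a λ k → sumTo b λ l →
    f i j k l * g (m - i) (n - j) (a - k) (b - l)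

α· : PS → PS
α· f m n zero b = 0ℚ
α· f m n (suc a) b = f m n a b

β· : PS → PS
β· f m n a zero = 0ℚ
β· f m n a (suc b) = f m n a b

∫x : PS → PS
∫x f zero n a b = 0ℚ
∫x f (suc m) n a b = f m n a b * ((+ 1) / suc m)

∫y : PS → PS
∫y f m zero a b = 0ℚ
∫y f m (suc n) a b = f m n a b * ((+ 1) / suc n)

expCoeff : ℕ → ℕ → ℕ → ℚ
expCoeff c m n = (+ c / (m ! Data.Nat.* n !)) {{m !* n !≢0}}
  where import Data.Nat

Gαβ : (ℕ → ℕ → Maybe ℕ → Maybe ℕ → ℕ) → PS
Gαβ c m n a b = expCoeff (c m n (just a) (just b)) m n

-- G^{(α,1)}: β specialised to 1 (no β-dependence)
Gα1 : (ℕ → ℕ → Maybe ℕ → Maybe ℕ → ℕ) → PS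
Gα1 c m n a zero = expCoeff (c m n (just a) nothing) m n
Gα1 c m n a (suc b) = 0ℚ

-- G^{(1,β)}: α specialised to 1 (no α-dependence)
G1β : (ℕ → ℕ → Maybe ℕ → Maybe ℕ → ℕ) → PS
G1β c m n zero b = expCoeff (c m n nothing (just b)) m n
G1β c m n (suc a) b = 0ℚ

-- A non-ambiguous tree is cut at its root into a left part (the root with its left subtree)
-- and a right part. Recording in a word w which left labels, and in a word v which right
-- labels, go to the left part, and standardising the labels of each part by rank, gives a
-- bijection between trees with m left and n right labels and such (w, v, left part, right
-- part). Summing over the words produces the binomial coefficients that turn a product of
-- exponential generating functions into a Cauchy product. A left part is either the bare
-- root or a root whose left child carries the largest left label above a non-ambiguous tree,
-- which accounts for 1 + α ∫ G^(α,1); right parts are symmetric.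

module Submission where

open import Defs
open import Data.Bool using (Bool; true; false; T; not; _∧_; if_then_else_)
open import Data.Bool.ListAction using (all; and)
open import Data.Bool.Properties as Bool using (T-∧; T-≡; T-not-≡; T-irrelevant)
open import Data.Empty using (⊥-elim)
open import Data.Fin using (Fin)
open import Data.Fin.Permutation using (↔⇒≡)
open import Data.Fin.Properties using (0↔⊥; 1↔⊤; +↔⊎; *↔×)
import Data.Integer as ℤ
import Data.Integer.Properties as ℤ
open import Data.List using (List; []; _∷_; _++_; length; map; applyUpTo)
open import Data.List.Membership.Propositional using (_∈_; _─_)
open import Data.List.Membership.Propositional.Properties using (∈-applyUpTo⁺; ∈-map⁺; ∈-map⁻; ∈-++⁺ˡ; ∈-++⁺ʳ)
open import Data.List.Properties
  using (length-applyUpTo; length-++; length-map; map-++; map-∘; map-cong; ++-identityʳ)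
open import Data.List.Relation.Binary.Disjoint.Propositional using (Disjoint)
open import Data.List.Relation.Binary.Subset.Propositional using (_⊆_)
open import Data.List.Relation.Unary.All as All using (All; []; _∷_)
open import Data.List.Relation.Unary.All.Properties as All using (all⁺; all⁻; ¬Any⇒All¬; All¬⇒¬Any; ++⁻ˡ; ++⁻ʳ)
open import Data.List.Relation.Unary.AllPairs as AllPairs using ([]; _∷_)
open import Data.List.Relation.Unary.Any as Any using (here; there)
open import Data.List.Relation.Unary.Any.Properties using (any⁺; any⁻)
open import Data.List.Relation.Unary.Unique.Propositional using (Unique)
import Data.List.Relation.Unary.Unique.Propositional.Properties as Unique
open import Data.Maybe using (Maybe; just; nothing)
open import Data.Nat using (ℕ; zero; suc; pred; _+_; _*_; _∸_; _!; NonZero; _≤_; _<_; z≤n; s≤s; _≡ᵇ_; _<ᵇ_)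
open import Data.Nat.Combinatorics using (_C_; k>n⇒nCk≡0; nCk+nC[k+1]≡[n+1]C[k+1]; nCk≡n!/k![n-k]!; k![n∸k]!∣n!)
open import Data.Nat.DivMod using (m/n*n≡m)
open import Data.Nat.Properties
open import Algebra.Properties.CommutativeSemigroup +-commutativeSemigroup using (x∙yz≈y∙xz)
open import Data.Nat.Tactic.RingSolver using (solve-∀)
open import Data.List.Membership.DecPropositional _≟_ using (_∈?_)
open import Data.Product using (Σ; _×_; _,_; proj₁; proj₂)
open import Data.Product.Function.Dependent.Propositional using (Σ-↔)
open import Data.Product.Function.NonDependent.Propositional using (_×-↔_)
open import Data.Rational as ℚ using (ℚ; 0ℚ; toℚᵘ)
open import Data.Rational.Properties as ℚ using (toℚᵘ-injective; toℚᵘ-fromℚᵘ; toℚᵘ-homo-*; toℚᵘ-homo-+)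
open import Data.Rational.Unnormalised as ℚᵘ using (mkℚᵘ)
import Data.Rational.Unnormalised.Properties as ℚᵘ
open import Data.Sum using (_⊎_; inj₁; inj₂)
open import Data.Sum.Function.Propositional using (_⊎-↔_)
open import Data.Vec using (Vec; []; _∷_)
open import Function using (_∘_; Equivalence; case_of_; _↔_; mk↔ₛ′)
open import Function.Properties.Inverse using (↔-sym; ↔-trans; ↔-refl)
open import Relation.Binary.Core using (_Preserves_⟶_)
open import Relation.Binary.Definitions using (tri<; tri≈; tri>)
open import Relation.Binary.PropositionalEquality
open import Relation.Nullary using (¬_; yes; no; does)

private variable A B : Set

∈-removal : ∀ {x y : A} {ys} (p : y ∈ ys) → x ∈ ys → x ≢ y → x ∈ (ys ─ p)
∈-removal (here refl) (here refl) x≢y = ⊥-elim (x≢y refl)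
∈-removal (here refl) (there q)   _   = q
∈-removal (there p)   (here refl) _   = here refl
∈-removal (there p)   (there q)   x≢y = there (∈-removal p q x≢y)

length-removal : ∀ {y : A} {ys} (p : y ∈ ys) → suc (length (ys ─ p)) ≡ length ys
length-removal (here refl) = refl
length-removal (there p)   = cong suc (length-removal p)

unique⇒length-mono-⊆ : ∀ {xs ys : List A} → Unique xs → xs ⊆ ys → length xs ≤ length ys
unique⇒length-mono-⊆ {xs = []}     _             _     = z≤n
unique⇒length-mono-⊆ {xs = x ∷ xs} {ys} (x≢xs ∷ uniq) xs⊆ys =
  subst (suc (length xs) ≤_) (length-removal x∈ys)
    (s≤s (unique⇒length-mono-⊆ uniq λ z∈xs →
      ∈-removal x∈ys (xs⊆ys (there z∈xs)) (λ { refl → All.lookup x≢xs z∈xs refl })))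
  where
  x∈ys : x ∈ ys
  x∈ys = xs⊆ys (here refl)

Unique-map⁺ : ∀ {P : A → Set} {f : A → B} {xs} → (∀ {x y} → P x → P y → f x ≡ f y → x ≡ y) →
              All P xs → Unique xs → Unique (map f xs)
Unique-map⁺ inj []         []            = []
Unique-map⁺ inj (px ∷ pxs) (x≢xs ∷ uniq) =
  All.map⁺ (All.zipWith (λ (x≢y , py) fx≡fy → x≢y (inj px py fx≡fy)) (x≢xs , pxs))
  ∷ Unique-map⁺ inj pxs uniq

Unique-++⁻ : ∀ (xs : List A) {ys} → Unique (xs ++ ys) → Unique xs × Unique ys × Disjoint xs ys
Unique-++⁻ []       uniq          = [] , uniq , λ ()
Unique-++⁻ (x ∷ xs) (x≢xs ∷ uniq) =
  let uxs , uys , disj = Unique-++⁻ xs uniq in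
  ++⁻ˡ xs x≢xs ∷ uxs , uys ,
  λ { (here refl , v∈ys) → All.lookup (++⁻ʳ xs x≢xs) v∈ys refl
    ; (there v∈xs , v∈ys) → disj (v∈xs , v∈ys) }

InRange : ℕ → ℕ → Set
InRange N x = 1 ≤ x × x ≤ N

record Labelling (N : ℕ) (xs : List ℕ) : Set where
  field
    length≡ : length xs ≡ N
    unique  : Unique xs
    inRange : All (InRange N) xs

upTo₁ : ℕ → List ℕ
upTo₁ = applyUpTo suc

∈-upTo₁ : ∀ {N x} → InRange N x → x ∈ upTo₁ N
∈-upTo₁ {x = suc i} (_ , i<N) = ∈-applyUpTo⁺ suc i<N

unique⇒length≤ : ∀ {N xs} → Unique xs → All (InRange N) xs → length xs ≤ N
unique⇒length≤ {N} uniq inRange =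
  subst (_ ≤_) (length-applyUpTo suc N)
    (unique⇒length-mono-⊆ uniq (∈-upTo₁ ∘ All.lookup inRange))

Labelling-covers : ∀ {N xs k} → Labelling N xs → InRange N k → k ∈ xs
Labelling-covers {N} {xs} {k} lab k∈[1,N] with k ∈? xs
... | yes k∈xs = k∈xs
... | no  k∉xs = ⊥-elim (<-irrefl refl (subst (_≤ N) (cong suc length≡)
      (unique⇒length≤ (¬Any⇒All¬ xs k∉xs ∷ unique) (k∈[1,N] ∷ inRange))))
  where open Labelling lab

Labelling-top : ∀ {i k ls} → Labelling (suc i) (k ∷ ls) → All (_< k) ls →
                k ≡ suc i × Labelling i ls
Labelling-top {k = zero} lab _ with () ← proj₁ (All.head (Labelling.inRange lab))
Labelling-top {i} {suc k} {ls} lab ls<k = cong suc k≡i , record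
  { length≡ = suc-injective length≡
  ; unique  = AllPairs.tail unique
  ; inRange = subst (λ N → All (InRange N) ls) k≡i ls∈[1,k] }
  where
  open Labelling lab
  ls∈[1,k] : All (InRange k) ls
  ls∈[1,k] = All.zipWith (λ ((1≤x , _) , x<k) → 1≤x , ≤-pred x<k) (All.tail inRange , ls<k)
  k≡i : k ≡ i
  k≡i = ≤-antisym (≤-pred (proj₂ (All.head inRange)))
          (subst (_≤ k) (suc-injective length≡) (unique⇒length≤ (AllPairs.tail unique) ls∈[1,k]))

Labelling-push : ∀ {i ls} → Labelling i ls → Labelling (suc i) (suc i ∷ ls) × All (_< suc i) ls
Labelling-push {i} {ls} lab = record
  { length≡ = cong suc length≡
  ; unique  = All.map (λ (_ , x≤i) → <⇒≢ (s≤s x≤i) ∘ sym) inRange ∷ unique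
  ; inRange = (s≤s z≤n , ≤-refl) ∷ All.map (λ (1≤x , x≤i) → 1≤x , m≤n⇒m≤1+n x≤i) inRange }
  , All.map (s≤s ∘ proj₂) inRange
  where open Labelling lab

Labelling-++[]⁻ : ∀ {N xs} → Labelling N (xs ++ []) → Labelling N xs
Labelling-++[]⁻ {N} {xs} = subst (Labelling N) (++-identityʳ xs)

Labelling-++[]⁺ : ∀ {N xs} → Labelling N xs → Labelling N (xs ++ [])
Labelling-++[]⁺ {N} {xs} = subst (Labelling N) (sym (++-identityʳ xs))

private
  T∧⁻ : ∀ {x y} → T (x ∧ y) → T x × T y
  T∧⁻ = Equivalence.to T-∧

  T∧⁺ : ∀ {x y} → T x → T y → T (x ∧ y)
  T∧⁺ p q = Equivalence.from T-∧ (p , q)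

  T-not⁻ : ∀ {x} → T (not x) → ¬ T x
  T-not⁻ {false} _ ()

  T-not⁺ : ∀ {x} → ¬ T x → T (not x)
  T-not⁺ {true}  ¬x = ¬x _
  T-not⁺ {false} _  = _

  T⇒≡true : ∀ {x} → T x → x ≡ true
  T⇒≡true = Equivalence.to T-≡

  ¬T⇒≡false : ∀ {x} → ¬ T x → x ≡ false
  ¬T⇒≡false = Equivalence.to T-not-≡ ∘ T-not⁺

  T-ext : ∀ {x y} → (T x → T y) → (T y → T x) → x ≡ y
  T-ext {true}  {true}  _   _   = refl
  T-ext {false} {false} _   _   = refl
  T-ext {true}  {false} x⇒y _   = ⊥-elim (x⇒y _)
  T-ext {false} {true}  _   y⇒x = ⊥-elim (y⇒x _)

Σ-T-≡ : ∀ {P : A → Bool} {x y : Σ A (T ∘ P)} → proj₁ x ≡ proj₁ y → x ≡ y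
Σ-T-≡ {x = a , p} {y = .a , q} refl = cong (a ,_) (T-irrelevant p q)

elemᵇ⇒∈ : ∀ {k} xs → T (elemᵇ k xs) → k ∈ xs
elemᵇ⇒∈ {k} xs = Any.map (λ {x} → ≡ᵇ⇒≡ k x) ∘ any⁻ _ xs

∈⇒elemᵇ : ∀ {k xs} → k ∈ xs → T (elemᵇ k xs)
∈⇒elemᵇ {k} = any⁺ _ ∘ Any.map (λ {x} → ≡⇒≡ᵇ k x)

distinctᵇ⇒Unique : ∀ xs → T (distinctᵇ xs) → Unique xs
distinctᵇ⇒Unique []       _ = []
distinctᵇ⇒Unique (x ∷ xs) h =
  ¬Any⇒All¬ xs (T-not⁻ (proj₁ (T∧⁻ h)) ∘ ∈⇒elemᵇ) ∷ distinctᵇ⇒Unique xs (proj₂ (T∧⁻ h))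

Unique⇒distinctᵇ : ∀ {xs} → Unique xs → T (distinctᵇ xs)
Unique⇒distinctᵇ []            = _
Unique⇒distinctᵇ (x∉xs ∷ uniq) =
  T∧⁺ (T-not⁺ (All¬⇒¬Any x∉xs ∘ elemᵇ⇒∈ _)) (Unique⇒distinctᵇ uniq)

isLabelling⇒Labelling : ∀ {N xs} → N ≡ length xs → T (isLabelling xs) → Labelling N xs
isLabelling⇒Labelling {xs = xs} refl h = record
  { length≡ = refl
  ; unique  = distinctᵇ⇒Unique xs (proj₁ (T∧⁻ h))
  ; inRange = All.map inRange (all⁺ _ xs (proj₂ (T∧⁻ h))) }
  where
  inRange : ∀ {x} → T ((0 <ᵇ x) ∧ (x <ᵇ suc (length xs))) → InRange (length xs) x
  inRange {x} h = <ᵇ⇒< 0 x (proj₁ (T∧⁻ h)) , ≤-pred (<ᵇ⇒< x _ (proj₂ (T∧⁻ h)))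

Labelling⇒isLabelling : ∀ {N xs} → Labelling N xs → T (isLabelling xs)
Labelling⇒isLabelling record { length≡ = refl ; unique = unique ; inRange = inRange } =
  T∧⁺ (Unique⇒distinctᵇ unique) (all⁻ _ (All.map (λ (1≤x , x≤N) → T∧⁺ (<⇒<ᵇ 1≤x) (<⇒<ᵇ (s≤s x≤N))) inRange))

record Selected (m n : ℕ) (a b : Maybe ℕ) (t : LTree) : Set where
  field
    leftLabelling  : Labelling m (leftLabels t)
    rightLabelling : Labelling n (rightLabels t)
    ancestry       : T (ancestorOK t)
    leftBranch     : T (matches a (LO t))
    rightBranch    : T (matches b (RO t))

selNAT⇒Selected : ∀ {m n a b} t → T (selNAT m n a b t) → Selected m n a b t
selNAT⇒Selected {m} {n} {a} t h =
  let nat , stats₁ = T∧⁻ {isNAT t} h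
      lL  , lR&anc = T∧⁻ {isLabelling (leftLabels t)} nat
      lR  , anc    = T∧⁻ {isLabelling (rightLabels t)} lR&anc
      m≡  , stats₂ = T∧⁻ {m ≡ᵇ nLV t} stats₁
      n≡  , stats₃ = T∧⁻ {n ≡ᵇ nRV t} stats₂
      lo  , ro     = T∧⁻ {matches a (LO t)} stats₃
  in record
    { leftLabelling  = isLabelling⇒Labelling (≡ᵇ⇒≡ m _ m≡) lL
    ; rightLabelling = isLabelling⇒Labelling (≡ᵇ⇒≡ n _ n≡) lR
    ; ancestry       = anc
    ; leftBranch     = lo
    ; rightBranch    = ro }

Selected⇒selNAT : ∀ {m n a b t} → Selected m n a b t → T (selNAT m n a b t)
Selected⇒selNAT {m} {n} sel =
  T∧⁺ (T∧⁺ (Labelling⇒isLabelling leftLabelling) (T∧⁺ (Labelling⇒isLabelling rightLabelling) ancestry))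
      (T∧⁺ (≡⇒≡ᵇ m _ (sym (Labelling.length≡ leftLabelling)))
      (T∧⁺ (≡⇒≡ᵇ n _ (sym (Labelling.length≡ rightLabelling))) (T∧⁺ leftBranch rightBranch)))
  where open Selected sel

-- Rank and select in words over Bool

-- Positions in a word are counted from 1. On the empty word rank and select are
-- both the identity, which makes rank-select hold without a range condition.

select : ∀ {m} → Bool → Vec Bool m → ℕ → ℕ
select b []      k       = k
select b (c ∷ w) zero    = zero
select b (c ∷ w) (suc k) = suc (if does (b Bool.≟ c) then select b w k else select b w (suc k))

rank : ∀ {m} → Bool → Vec Bool m → ℕ → ℕ
rank b []      p       = p
rank b (c ∷ w) zero    = zero
rank b (c ∷ w) (suc p) = if does (b Bool.≟ c) then suc (rank b w p) else rank b w p

count : ∀ {m} → Bool → Vec Bool m → ℕ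
count b []      = 0
count b (c ∷ w) = if does (b Bool.≟ c) then suc (count b w) else count b w

data Occurs (b : Bool) : ∀ {m} → Vec Bool m → ℕ → Set where
  here  : ∀ {m} {w : Vec Bool m} → Occurs b (b ∷ w) 1
  there : ∀ {m c p} {w : Vec Bool m} → Occurs b w p → Occurs b (c ∷ w) (suc p)

select-zero : ∀ {m} b (w : Vec Bool m) → select b w 0 ≡ 0
select-zero b []      = refl
select-zero b (_ ∷ _) = refl

rank-zero : ∀ {m} b (w : Vec Bool m) → rank b w 0 ≡ 0
rank-zero b []      = refl
rank-zero b (_ ∷ _) = refl

rank-inRange : ∀ {m b p} {w : Vec Bool m} → Occurs b w p → InRange (count b w) (rank b w p)
rank-inRange {b = true}  (here {w = w}) = s≤s z≤n , s≤s (subst (_≤ count true w) (sym (rank-zero true w)) z≤n)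
rank-inRange {b = false} (here {w = w}) = s≤s z≤n , s≤s (subst (_≤ count false w) (sym (rank-zero false w)) z≤n)
rank-inRange {b = b} (there {c = c} occ) with b Bool.≟ c | rank-inRange occ
... | yes _ | _ , r≤count = s≤s z≤n , s≤s r≤count
... | no  _ | r∈range     = r∈range

-- In select-rank and rank-select the letters are split concretely: the composite unfolds
-- does (b ≟ c) a second time after any with-abstraction, and it only computes on literals.
select-rank : ∀ {m b p} {w : Vec Bool m} → Occurs b w p → select b w (rank b w p) ≡ p
select-rank {b = true}  (here {w = w}) = cong suc (trans (cong (select true w) (rank-zero true w)) (select-zero true w))
select-rank {b = false} (here {w = w}) = cong suc (trans (cong (select false w) (rank-zero false w)) (select-zero false w))
select-rank {b = true}  (there {c = true}  occ) = cong suc (select-rank occ)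
select-rank {b = true}  (there {c = false} {p} {w} occ)
  with rank true w p | rank-inRange occ | select-rank occ
... | suc _ | _ | eq = cong suc eq
select-rank {b = false} (there {c = true} {p} {w} occ)
  with rank false w p | rank-inRange occ | select-rank occ
... | suc _ | _ | eq = cong suc eq
select-rank {b = false} (there {c = false} occ) = cong suc (select-rank occ)

rank-select : ∀ {m} b (w : Vec Bool m) k → rank b w (select b w k) ≡ k
rank-select b     []          k       = refl
rank-select true  (true  ∷ w) zero    = refl
rank-select true  (true  ∷ w) (suc k) = cong suc (rank-select true w k)
rank-select false (false ∷ w) zero    = refl
rank-select false (false ∷ w) (suc k) = cong suc (rank-select false w k)
rank-select true  (false ∷ w) zero    = refl
rank-select true  (false ∷ w) (suc k) = rank-select true w (suc k)
rank-select false (true  ∷ w) zero    = refl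
rank-select false (true  ∷ w) (suc k) = rank-select false w (suc k)

select-occurs : ∀ {m b k} (w : Vec Bool m) → InRange (count b w) k → Occurs b w (select b w k)
select-occurs {b = b} {k = suc k} (c ∷ w) (_ , k<count) with b Bool.≟ c | k
... | yes refl | zero   = subst (Occurs b (b ∷ w) ∘ suc) (sym (select-zero b w)) here
... | yes refl | suc _  = there (select-occurs w (s≤s z≤n , ≤-pred k<count))
... | no  _    | _      = there (select-occurs w (s≤s z≤n , k<count))

Occurs-inRange : ∀ {m b p} {w : Vec Bool m} → Occurs b w p → InRange m p
Occurs-inRange here        = s≤s z≤n , s≤s z≤n
Occurs-inRange (there occ) = s≤s z≤n , s≤s (proj₂ (Occurs-inRange occ))

Occurs-functional : ∀ {m b c p} {w : Vec Bool m} → Occurs b w p → Occurs c w p → b ≡ c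
Occurs-functional here        here        = refl
Occurs-functional (there occ) (there occ′) = Occurs-functional occ occ′
Occurs-functional here        (there ())
Occurs-functional (there ())  here

count-true+count-false : ∀ {m} (w : Vec Bool m) → count true w + count false w ≡ m
count-true+count-false []          = refl
count-true+count-false (true  ∷ w) = cong suc (count-true+count-false w)
count-true+count-false (false ∷ w) =
  trans (+-suc (count true w) (count false w)) (cong suc (count-true+count-false w))

select-mono-< : ∀ {m} b (w : Vec Bool m) → select b w Preserves _<_ ⟶ _<_
select-mono-< b []      x<y = x<y
select-mono-< b (c ∷ w) {zero}  {suc y} _   = s≤s z≤n
select-mono-< b (c ∷ w) {suc x} {suc y} x<y with b Bool.≟ c
... | yes _ = s≤s (select-mono-< b w (≤-pred x<y))
... | no  _ = s≤s (select-mono-< b w x<y)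

tabulate₁ : (ℕ → Bool) → ∀ m → Vec Bool m
tabulate₁ f zero    = []
tabulate₁ f (suc m) = f 1 ∷ tabulate₁ (f ∘ suc) m

Occurs-tabulate₁⁺ : ∀ {m b p} f → InRange m p → f p ≡ b → Occurs b (tabulate₁ f m) p
Occurs-tabulate₁⁺ {suc m} {p = suc zero}    f _             refl = here
Occurs-tabulate₁⁺ {suc m} {p = suc (suc p)} f (_ , s≤s p<m) fp≡b =
  there (Occurs-tabulate₁⁺ (f ∘ suc) (s≤s z≤n , p<m) fp≡b)

tabulate₁-unique : ∀ {m} (w : Vec Bool m) f → (∀ {b p} → Occurs b w p → f p ≡ b) → tabulate₁ f m ≡ w
tabulate₁-unique []      f _ = refl
tabulate₁-unique (c ∷ w) f h = cong₂ _∷_ (h here) (tabulate₁-unique w (f ∘ suc) (h ∘ there))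

select-injective : ∀ {m} b (w : Vec Bool m) {x y} → select b w x ≡ select b w y → x ≡ y
select-injective b w {x} {y} eq =
  trans (sym (rank-select b w x)) (trans (cong (rank b w) eq) (rank-select b w y))

rank-injectiveOn : ∀ {m b x y} {w : Vec Bool m} → Occurs b w x → Occurs b w y →
                   rank b w x ≡ rank b w y → x ≡ y
rank-injectiveOn {b = b} {w = w} occx occy eq =
  trans (sym (select-rank occx)) (trans (cong (select b w) eq) (select-rank occy))

select-Labelling : ∀ {m} (w : Vec Bool m) {xs ys} →
                   Labelling (count true w) xs → Labelling (count false w) ys →
                   Labelling m (map (select true w) xs ++ map (select false w) ys)
select-Labelling {m} w {xs} {ys} labT labF = record
  { length≡ = begin
      length (map (select true w) xs ++ map (select false w) ys)
        ≡⟨ length-++ (map (select true w) xs) ⟩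
      length (map (select true w) xs) + length (map (select false w) ys)
        ≡⟨ cong₂ _+_ (trans (length-map _ xs) (Labelling.length≡ labT))
                     (trans (length-map _ ys) (Labelling.length≡ labF)) ⟩
      count true w + count false w
        ≡⟨ count-true+count-false w ⟩
      m ∎
  ; unique  = Unique.++⁺ (Unique.map⁺ (select-injective true w) (Labelling.unique labT))
                         (Unique.map⁺ (select-injective false w) (Labelling.unique labF))
                         (λ (p∈xs , p∈ys) → true≢false (Occurs-functional (All.lookup occT p∈xs) (All.lookup occF p∈ys)))
  ; inRange = All.++⁺ (All.map Occurs-inRange occT) (All.map Occurs-inRange occF) }
  where
  open ≡-Reasoning
  true≢false : true ≢ false
  true≢false ()
  selected-occur : ∀ {b zs} → Labelling (count b w) zs → All (Occurs b w) (map (select b w) zs)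
  selected-occur lab = All.map⁺ (All.map (select-occurs w) (Labelling.inRange lab))
  occT : All (Occurs true w) (map (select true w) xs)
  occT = selected-occur labT
  occF : All (Occurs false w) (map (select false w) ys)
  occF = selected-occur labF

+-squeeze : ∀ {a b c d} → a ≤ c → b ≤ d → a + b ≡ c + d → a ≡ c × b ≡ d
+-squeeze {a} {b} {c} {d} a≤c b≤d eq = a≡c , +-cancelˡ-≡ a b d (trans eq (cong (_+ d) (sym a≡c)))
  where
  a≡c : a ≡ c
  a≡c = ≤-antisym a≤c (+-cancelʳ-≤ d c a (subst (_≤ a + d) eq (+-monoʳ-≤ a b≤d)))

-- The lengths come from pigeonhole: each ranked list is duplicate-free within its range,
-- and the two ranges add up to m.
rank-Labelling : ∀ {m} (w : Vec Bool m) {us vs} → Labelling m (us ++ vs) →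
                 All (Occurs true w) us → All (Occurs false w) vs →
                 Labelling (count true w) (map (rank true w) us) ×
                 Labelling (count false w) (map (rank false w) vs)
rank-Labelling {m} w {us} {vs} lab occT occF =
  record { length≡ = proj₁ lengths ; unique = uniqueT ; inRange = ranked-inRange occT } ,
  record { length≡ = proj₂ lengths ; unique = uniqueF ; inRange = ranked-inRange occF }
  where
  open Labelling lab
  ranked-unique : ∀ {b zs} → All (Occurs b w) zs → Unique zs → Unique (map (rank b w) zs)
  ranked-unique = Unique-map⁺ rank-injectiveOn
  ranked-inRange : ∀ {b zs} → All (Occurs b w) zs → All (InRange (count b w)) (map (rank b w) zs)
  ranked-inRange occ = All.map⁺ (All.map rank-inRange occ)
  uniqueT : Unique (map (rank true w) us)
  uniqueT = ranked-unique occT (proj₁ (Unique-++⁻ us unique))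
  uniqueF : Unique (map (rank false w) vs)
  uniqueF = ranked-unique occF (proj₁ (proj₂ (Unique-++⁻ us unique)))
  lengths : length (map (rank true w) us) ≡ count true w × length (map (rank false w) vs) ≡ count false w
  lengths = +-squeeze (unique⇒length≤ uniqueT (ranked-inRange occT))
                      (unique⇒length≤ uniqueF (ranked-inRange occF))
                      (begin
    length (map (rank true w) us) + length (map (rank false w) vs) ≡⟨ cong₂ _+_ (length-map _ us) (length-map _ vs) ⟩
    length us + length vs                                           ≡⟨ length-++ us ⟨
    length (us ++ vs)                                               ≡⟨ length≡ ⟩
    m                                                               ≡⟨ count-true+count-false w ⟨
    count true w + count false w                                    ∎)
    where open ≡-Reasoning

indicator : List ℕ → ∀ m → Vec Bool m
indicator us = tabulate₁ (λ p → elemᵇ p us)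

indicator-occurs : ∀ {m} us {vs} → Labelling m (us ++ vs) →
                   All (Occurs true (indicator us m)) us × All (Occurs false (indicator us m)) vs
indicator-occurs us {vs} lab =
  All.tabulate (λ u∈us → Occurs-tabulate₁⁺ _ (All.lookup inRange (∈-++⁺ˡ u∈us)) (T⇒≡true (∈⇒elemᵇ u∈us))) ,
  All.tabulate (λ v∈vs → Occurs-tabulate₁⁺ _ (All.lookup inRange (∈-++⁺ʳ us v∈vs))
                           (¬T⇒≡false (λ v∈us → disjoint (elemᵇ⇒∈ us v∈us , v∈vs))))
  where
  open Labelling lab
  disjoint : Disjoint us vs
  disjoint = proj₂ (proj₂ (Unique-++⁻ us unique))

indicator-select : ∀ {m} (w : Vec Bool m) {xs} → Labelling (count true w) xs →
                   indicator (map (select true w) xs) m ≡ w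
indicator-select w {xs} lab = tabulate₁-unique w _ letter≡
  where
  letter≡ : ∀ {b p} → Occurs b w p → elemᵇ p (map (select true w) xs) ≡ b
  letter≡ {true} occ = T⇒≡true (∈⇒elemᵇ (subst (_∈ map (select true w) xs) (select-rank occ)
    (∈-map⁺ (select true w) (Labelling-covers lab (rank-inRange occ)))))
  letter≡ {false} occ = ¬T⇒≡false λ p∈ →
    let x , x∈xs , p≡ = ∈-map⁻ (select true w) (elemᵇ⇒∈ _ p∈)
        occT = subst (Occurs true w) (sym p≡) (select-occurs w (All.lookup (Labelling.inRange lab) x∈xs))
    in case Occurs-functional occT occ of λ ()

Child : Set
Child = Maybe (ℕ × LTree)

mutual
  relabel : (ℕ → ℕ) → (ℕ → ℕ) → LTree → LTree
  relabel f g (node l r) = node (relabelChild f f g l) (relabelChild g f g r)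

  relabelChild : (ℕ → ℕ) → (ℕ → ℕ) → (ℕ → ℕ) → Child → Child
  relabelChild h f g nothing        = nothing
  relabelChild h f g (just (k , s)) = just (h k , relabel f g s)

mutual
  leftLabels-relabel : ∀ f g t → leftLabels (relabel f g t) ≡ map f (leftLabels t)
  leftLabels-relabel f g (node l r) =
    trans (cong₂ _++_ (leftL-relabelChild f g l) (leftR-relabelChild g f g r))
          (sym (map-++ f (leftL l) (leftR r)))

  leftL-relabelChild : ∀ f g l → leftL (relabelChild f f g l) ≡ map f (leftL l)
  leftL-relabelChild f g nothing        = refl
  leftL-relabelChild f g (just (k , s)) = cong (f k ∷_) (leftLabels-relabel f g s)

  leftR-relabelChild : ∀ h f g r → leftR (relabelChild h f g r) ≡ map f (leftR r)
  leftR-relabelChild h f g nothing        = refl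
  leftR-relabelChild h f g (just (k , s)) = leftLabels-relabel f g s

mutual
  rightLabels-relabel : ∀ f g t → rightLabels (relabel f g t) ≡ map g (rightLabels t)
  rightLabels-relabel f g (node l r) =
    trans (cong₂ _++_ (rightL-relabelChild f f g l) (rightR-relabelChild f g r))
          (sym (map-++ g (rightL l) (rightR r)))

  rightL-relabelChild : ∀ h f g l → rightL (relabelChild h f g l) ≡ map g (rightL l)
  rightL-relabelChild h f g nothing        = refl
  rightL-relabelChild h f g (just (k , s)) = rightLabels-relabel f g s

  rightR-relabelChild : ∀ f g r → rightR (relabelChild g f g r) ≡ map g (rightR r)
  rightR-relabelChild f g nothing        = refl
  rightR-relabelChild f g (just (k , s)) = cong (g k ∷_) (rightLabels-relabel f g s)

LO-relabel : ∀ f g t → LO (relabel f g t) ≡ LO t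
LO-relabel f g (node nothing        r) = refl
LO-relabel f g (node (just (k , s)) r) = cong suc (LO-relabel f g s)

LO-relabelChild : ∀ h f g l r r′ → LO (node (relabelChild h f g l) r) ≡ LO (node l r′)
LO-relabelChild h f g nothing        r r′ = refl
LO-relabelChild h f g (just (k , s)) r r′ = cong suc (LO-relabel f g s)

RO-relabel : ∀ f g t → RO (relabel f g t) ≡ RO t
RO-relabel f g (node l nothing)        = refl
RO-relabel f g (node l (just (k , s))) = cong suc (RO-relabel f g s)

RO-relabelChild : ∀ h f g l l′ r → RO (node l (relabelChild h f g r)) ≡ RO (node l′ r)
RO-relabelChild h f g l l′ nothing        = refl
RO-relabelChild h f g l l′ (just (k , s)) = cong suc (RO-relabel f g s)

module _ {f : ℕ → ℕ} (f-mono : f Preserves _<_ ⟶ _<_) where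

  mono-<-reflects : ∀ {x y} → f x < f y → x < y
  mono-<-reflects {x} {y} fx<fy with <-cmp x y
  ... | tri< x<y _    _   = x<y
  ... | tri≈ _   refl _   = ⊥-elim (<-irrefl refl fx<fy)
  ... | tri> _   _    y<x = ⊥-elim (<-asym fx<fy (f-mono y<x))

  <ᵇ-mono : ∀ x y → (f x <ᵇ f y) ≡ (x <ᵇ y)
  <ᵇ-mono x y = T-ext (<⇒<ᵇ ∘ mono-<-reflects ∘ <ᵇ⇒< _ _) (<⇒<ᵇ ∘ f-mono ∘ <ᵇ⇒< _ _)

  all-<ᵇ-map : ∀ k xs → all (_<ᵇ f k) (map f xs) ≡ all (_<ᵇ k) xs
  all-<ᵇ-map k xs = cong and (trans (sym (map-∘ xs)) (map-cong (λ x → <ᵇ-mono x k) xs))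

module _ {f g : ℕ → ℕ} (f-mono : f Preserves _<_ ⟶ _<_) (g-mono : g Preserves _<_ ⟶ _<_) where

  mutual
    ancestorOK-relabel : ∀ t → ancestorOK (relabel f g t) ≡ ancestorOK t
    ancestorOK-relabel (node l r) = cong₂ _∧_ (ancL-relabelChild l) (ancR-relabelChild r)

    ancL-relabelChild : ∀ l → ancL (relabelChild f f g l) ≡ ancL l
    ancL-relabelChild nothing        = refl
    ancL-relabelChild (just (k , s)) = cong₂ _∧_
      (trans (cong (all (_<ᵇ f k)) (leftLabels-relabel f g s)) (all-<ᵇ-map f-mono k (leftLabels s)))
      (ancestorOK-relabel s)

    ancR-relabelChild : ∀ r → ancR (relabelChild g f g r) ≡ ancR r
    ancR-relabelChild nothing        = refl
    ancR-relabelChild (just (k , s)) = cong₂ _∧_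
      (trans (cong (all (_<ᵇ g k)) (rightLabels-relabel f g s)) (all-<ᵇ-map g-mono k (rightLabels s)))
      (ancestorOK-relabel s)

module _ {f f′ g g′ : ℕ → ℕ} where

  mutual
    relabel-inverse : ∀ t → All (λ x → f′ (f x) ≡ x) (leftLabels t) → All (λ x → g′ (g x) ≡ x) (rightLabels t) →
                      relabel f′ g′ (relabel f g t) ≡ t
    relabel-inverse (node l r) invL invR = cong₂ node
      (relabelChild-inverseˡ l (++⁻ˡ (leftL l) invL) (++⁻ˡ (rightL l) invR))
      (relabelChild-inverseʳ r (++⁻ʳ (leftL l) invL) (++⁻ʳ (rightL l) invR))

    relabelChild-inverseˡ : ∀ l → All (λ x → f′ (f x) ≡ x) (leftL l) → All (λ x → g′ (g x) ≡ x) (rightL l) →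
                            relabelChild f′ f′ g′ (relabelChild f f g l) ≡ l
    relabelChild-inverseˡ nothing        _              _    = refl
    relabelChild-inverseˡ (just (k , s)) (invk ∷ invL) invR =
      cong₂ (λ k s → just (k , s)) invk (relabel-inverse s invL invR)

    relabelChild-inverseʳ : ∀ r → All (λ x → f′ (f x) ≡ x) (leftR r) → All (λ x → g′ (g x) ≡ x) (rightR r) →
                            relabelChild g′ f′ g′ (relabelChild g f g r) ≡ r
    relabelChild-inverseʳ nothing        _    _              = refl
    relabelChild-inverseʳ (just (k , s)) invL (invk ∷ invR) =
      cong₂ (λ k s → just (k , s)) invk (relabel-inverse s invL invR)

-- Cutting a tree at its root

LeftPart : ℕ → ℕ → ℕ → Set
LeftPart i j a = Σ Child λ l → T (selNAT i j (just a) (just 0) (node l nothing))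

RightPart : ℕ → ℕ → ℕ → Set
RightPart i j b = Σ Child λ r → T (selNAT i j (just 0) (just b) (node nothing r))

-- w and v record which left labels, resp. right labels, belong to the left part.
Decomposition : ℕ → ℕ → ℕ → ℕ → Set
Decomposition m n a b =
  Σ (Vec Bool m) λ w → Σ (Vec Bool n) λ v →
    LeftPart (count true w) (count true v) a × RightPart (count false w) (count false v) b

glueTree : ∀ {m n} → Vec Bool m → Vec Bool n → Child → Child → LTree
glueTree w v l r = node (relabelChild (select true w)  (select true w) (select true v)  l)
                        (relabelChild (select false v) (select false w) (select false v) r)

glue-Selected : ∀ {m n a b} (w : Vec Bool m) (v : Vec Bool n) {l r} →
                Selected (count true w) (count true v) (just a) (just 0) (node l nothing) →
                Selected (count false w) (count false v) (just 0) (just b) (node nothing r) →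
                Selected m n (just a) (just b) (glueTree w v l r)
glue-Selected {m} {n} {a} {b} w v {l} {r} L R = record
  { leftLabelling  = subst (Labelling m) (sym (cong₂ _++_ (leftL-relabelChild _ _ l) (leftR-relabelChild _ _ _ r)))
                       (select-Labelling w (Labelling-++[]⁻ L.leftLabelling) R.leftLabelling)
  ; rightLabelling = subst (Labelling n) (sym (cong₂ _++_ (rightL-relabelChild _ _ _ l) (rightR-relabelChild _ _ r)))
                       (select-Labelling v (Labelling-++[]⁻ L.rightLabelling) R.rightLabelling)
  ; ancestry       = T∧⁺ (subst T (sym (ancL-relabelChild (select-mono-< true w) (select-mono-< true v) l))
                               (proj₁ (T∧⁻ {ancL l} L.ancestry)))
                         (subst T (sym (ancR-relabelChild (select-mono-< false w) (select-mono-< false v) r))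
                               R.ancestry)
  ; leftBranch     = subst (T ∘ matches (just a)) (sym (LO-relabelChild _ _ _ l _ nothing)) L.leftBranch
  ; rightBranch    = subst (T ∘ matches (just b)) (sym (RO-relabelChild _ _ _ _ nothing r)) R.rightBranch }
  where
  module L = Selected L
  module R = Selected R

module Cutting {m n a b} (l r : Child) (h : T (selNAT m n (just a) (just b) (node l r))) where

  open Selected (selNAT⇒Selected {m} {n} {just a} {just b} (node l r) h)

  w : Vec Bool m
  w = indicator (leftL l) m

  v : Vec Bool n
  v = indicator (rightL l) n

  occurrencesL : All (Occurs true w) (leftL l) × All (Occurs false w) (leftR r)
  occurrencesL = indicator-occurs (leftL l) leftLabelling

  occurrencesR : All (Occurs true v) (rightL l) × All (Occurs false v) (rightR r)
  occurrencesR = indicator-occurs (rightL l) rightLabelling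

  l′ : Child
  l′ = relabelChild (rank true w) (rank true w) (rank true v) l

  r′ : Child
  r′ = relabelChild (rank false v) (rank false w) (rank false v) r

  glue-cutˡ : relabelChild (select true w) (select true w) (select true v) l′ ≡ l
  glue-cutˡ = relabelChild-inverseˡ l (All.map select-rank (proj₁ occurrencesL))
                                      (All.map select-rank (proj₁ occurrencesR))

  glue-cutʳ : relabelChild (select false v) (select false w) (select false v) r′ ≡ r
  glue-cutʳ = relabelChild-inverseʳ r (All.map select-rank (proj₂ occurrencesL))
                                      (All.map select-rank (proj₂ occurrencesR))

  leftLabellings : Labelling (count true w) (map (rank true w) (leftL l)) ×
                   Labelling (count false w) (map (rank false w) (leftR r))
  leftLabellings = rank-Labelling w leftLabelling (proj₁ occurrencesL) (proj₂ occurrencesL)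

  rightLabellings : Labelling (count true v) (map (rank true v) (rightL l)) ×
                    Labelling (count false v) (map (rank false v) (rightR r))
  rightLabellings = rank-Labelling v rightLabelling (proj₁ occurrencesR) (proj₂ occurrencesR)

  -- Ancestry transfers back along select, which is strictly monotone (rank is not).
  left-part : Selected (count true w) (count true v) (just a) (just 0) (node l′ nothing)
  left-part = record
    { leftLabelling  = Labelling-++[]⁺ (subst (Labelling _) (sym (leftL-relabelChild _ _ l)) (proj₁ leftLabellings))
    ; rightLabelling = Labelling-++[]⁺ (subst (Labelling _) (sym (rightL-relabelChild _ _ _ l)) (proj₁ rightLabellings))
    ; ancestry       = T∧⁺ (subst T (trans (cong ancL (sym glue-cutˡ))
                                       (ancL-relabelChild (select-mono-< true w) (select-mono-< true v) l′))
                                 (proj₁ (T∧⁻ {ancL l} ancestry)))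
                           _
    ; leftBranch     = subst (T ∘ matches (just a)) (sym (LO-relabelChild _ _ _ l nothing r)) leftBranch
    ; rightBranch    = _ }

  right-part : Selected (count false w) (count false v) (just 0) (just b) (node nothing r′)
  right-part = record
    { leftLabelling  = subst (Labelling _) (sym (leftR-relabelChild _ _ _ r)) (proj₂ leftLabellings)
    ; rightLabelling = subst (Labelling _) (sym (rightR-relabelChild _ _ r)) (proj₂ rightLabellings)
    ; ancestry       = subst T (trans (cong ancR (sym glue-cutʳ))
                                 (ancR-relabelChild (select-mono-< false w) (select-mono-< false v) r′))
                           (proj₂ (T∧⁻ {ancL l} ancestry))
    ; leftBranch     = _
    ; rightBranch    = subst (T ∘ matches (just b)) (sym (RO-relabelChild _ _ _ nothing l r)) rightBranch }

module _ {m n a b : ℕ} where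

  cut : NATset m n (just a) (just b) → Decomposition m n a b
  cut (node l r , h) = w , v , (l′ , Selected⇒selNAT left-part) , (r′ , Selected⇒selNAT right-part)
    where open Cutting {m} {n} {a} {b} l r h

  glue : Decomposition m n a b → NATset m n (just a) (just b)
  glue (w , v , (l , hl) , (r , hr)) =
    glueTree w v l r , Selected⇒selNAT (glue-Selected {a = a} {b = b} w v {l} {r}
      (selNAT⇒Selected {count true w}  {count true v}  {just a} {just 0} _ hl)
      (selNAT⇒Selected {count false w} {count false v} {just 0} {just b} _ hr))

  glue-cut : (t : NATset m n (just a) (just b)) → glue (cut t) ≡ t
  glue-cut (node l r , h) = Σ-T-≡ (cong₂ node glue-cutˡ glue-cutʳ)
    where open Cutting {m} {n} {a} {b} l r h

  Decomposition-≡ : ∀ {w w′ : Vec Bool m} {v v′ : Vec Bool n} {l l′ r r′ hl hl′ hr hr′} →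
                    w ≡ w′ → v ≡ v′ → l ≡ l′ → r ≡ r′ →
                    _≡_ {A = Decomposition m n a b} (w , v , (l , hl) , (r , hr)) (w′ , v′ , (l′ , hl′) , (r′ , hr′))
  Decomposition-≡ {hl = hl} {hl′} {hr = hr} {hr′} refl refl refl refl
    rewrite T-irrelevant hl hl′ | T-irrelevant hr hr′ = refl

  cut-glue : (d : Decomposition m n a b) → cut (glue d) ≡ d
  cut-glue (w , v , (l , hl) , (r , hr)) = Decomposition-≡ w≡ v≡
    (trans (cong₂ (λ w v → relabelChild (rank true w) (rank true w) (rank true v) l*) w≡ v≡)
           (relabelChild-inverseˡ l (All.universal (rank-select true w) _) (All.universal (rank-select true v) _)))
    (trans (cong₂ (λ w v → relabelChild (rank false v) (rank false w) (rank false v) r*) w≡ v≡)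
           (relabelChild-inverseʳ r (All.universal (rank-select false w) _) (All.universal (rank-select false v) _)))
    where
    module L = Selected (selNAT⇒Selected {count true w} {count true v} {just a} {just 0} (node l nothing) hl)
    l* : Child
    l* = relabelChild (select true w) (select true w) (select true v) l
    r* : Child
    r* = relabelChild (select false v) (select false w) (select false v) r
    w≡ : indicator (leftL l*) m ≡ w
    w≡ = trans (cong (λ xs → indicator xs m) (leftL-relabelChild _ _ l))
               (indicator-select w (Labelling-++[]⁻ L.leftLabelling))
    v≡ : indicator (rightL l*) n ≡ v
    v≡ = trans (cong (λ xs → indicator xs n) (rightL-relabelChild _ _ _ l))
               (indicator-select v (Labelling-++[]⁻ L.rightLabelling))

  NATset↔Decomposition : NATset m n (just a) (just b) ↔ Decomposition m n a b
  NATset↔Decomposition = mk↔ₛ′ cut glue cut-glue glue-cut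

-- Sums over words

sumToℕ : ℕ → (ℕ → ℕ) → ℕ
sumToℕ zero    f = f zero
sumToℕ (suc n) f = sumToℕ n f + f (suc n)

sumToℕ-cong : ∀ m {f g : ℕ → ℕ} → (∀ i → i ≤ m → f i ≡ g i) → sumToℕ m f ≡ sumToℕ m g
sumToℕ-cong zero    f≡g = f≡g 0 z≤n
sumToℕ-cong (suc m) f≡g =
  cong₂ _+_ (sumToℕ-cong m (λ i i≤m → f≡g i (m≤n⇒m≤1+n i≤m))) (f≡g (suc m) ≤-refl)

sumToℕ-+ : ∀ m (f g : ℕ → ℕ) → sumToℕ m (λ i → f i + g i) ≡ sumToℕ m f + sumToℕ m g
sumToℕ-+ zero    f g = refl
sumToℕ-+ (suc m) f g = begin
  sumToℕ m (λ i → f i + g i) + (f (suc m) + g (suc m)) ≡⟨ cong (_+ (f (suc m) + g (suc m))) (sumToℕ-+ m f g) ⟩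
  sumToℕ m f + sumToℕ m g + (f (suc m) + g (suc m))    ≡⟨ +-assoc (sumToℕ m f) (sumToℕ m g) (f (suc m) + g (suc m)) ⟩
  sumToℕ m f + (sumToℕ m g + (f (suc m) + g (suc m)))  ≡⟨ cong (sumToℕ m f +_) (x∙yz≈y∙xz (sumToℕ m g) (f (suc m)) (g (suc m))) ⟩
  sumToℕ m f + (f (suc m) + (sumToℕ m g + g (suc m)))  ≡⟨ +-assoc (sumToℕ m f) (f (suc m)) (sumToℕ m g + g (suc m)) ⟨
  sumToℕ m f + f (suc m) + (sumToℕ m g + g (suc m))    ∎
  where open ≡-Reasoning

sumToℕ-suc : ∀ m (f : ℕ → ℕ) → sumToℕ (suc m) f ≡ f 0 + sumToℕ m (f ∘ suc)
sumToℕ-suc zero    f = refl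
sumToℕ-suc (suc m) f = trans (cong (_+ f (suc (suc m))) (sumToℕ-suc m f))
                             (+-assoc (f 0) (sumToℕ m (f ∘ suc)) (f (suc (suc m))))

*-distribˡ-sumToℕ : ∀ m k (f : ℕ → ℕ) → k * sumToℕ m f ≡ sumToℕ m (λ i → k * f i)
*-distribˡ-sumToℕ zero    k f = refl
*-distribˡ-sumToℕ (suc m) k f =
  trans (*-distribˡ-+ k (sumToℕ m f) (f (suc m))) (cong (_+ k * f (suc m)) (*-distribˡ-sumToℕ m k f))

sumWords : ∀ m → (Vec Bool m → ℕ) → ℕ
sumWords zero    g = g []
sumWords (suc m) g = sumWords m (g ∘ (true ∷_)) + sumWords m (g ∘ (false ∷_))

sumWords-cong : ∀ m {f g : Vec Bool m → ℕ} → (∀ w → f w ≡ g w) → sumWords m f ≡ sumWords m g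
sumWords-cong zero    f≡g = f≡g []
sumWords-cong (suc m) f≡g = cong₂ _+_ (sumWords-cong m (f≡g ∘ (true ∷_))) (sumWords-cong m (f≡g ∘ (false ∷_)))

binomialSum : ℕ → (ℕ → ℕ → ℕ) → ℕ
binomialSum m f = sumToℕ m (λ i → (m C i) * f i (m ∸ i))

-- Pascal's rule, summed against f.
binomialSum-suc : ∀ m f → binomialSum (suc m) f ≡ binomialSum m (λ i → f (suc i)) + binomialSum m (λ i k → f i (suc k))
binomialSum-suc m f = begin
  sumToℕ (suc m) (λ i → (suc m C i) * F i)
    ≡⟨ sumToℕ-suc m _ ⟩
  1 * F 0 + sumToℕ m (λ i → (suc m C suc i) * F (suc i))
    ≡⟨ cong (1 * F 0 +_) (trans (sumToℕ-cong m (λ i _ → pascal i)) (sumToℕ-+ m (λ i → (m C i) * F (suc i)) (λ i → (m C suc i) * F (suc i)))) ⟩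
  1 * F 0 + (sumToℕ m (λ i → (m C i) * F (suc i)) + sumToℕ m (λ i → (m C suc i) * F (suc i)))
    ≡⟨ x∙yz≈y∙xz (1 * F 0) (sumToℕ m (λ i → (m C i) * F (suc i))) (sumToℕ m (λ i → (m C suc i) * F (suc i))) ⟩
  sumToℕ m (λ i → (m C i) * F (suc i)) + (1 * F 0 + sumToℕ m (λ i → (m C suc i) * F (suc i)))
    ≡⟨ cong (sumToℕ m (λ i → (m C i) * F (suc i)) +_) (sym (sumToℕ-suc m (λ i → (m C i) * F i))) ⟩
  sumToℕ m (λ i → (m C i) * F (suc i)) + (sumToℕ m (λ i → (m C i) * F i) + (m C suc m) * F (suc m))
    ≡⟨ cong (λ x → sumToℕ m (λ i → (m C i) * F (suc i)) + (sumToℕ m (λ i → (m C i) * F i) + x * F (suc m)))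
            (k>n⇒nCk≡0 (n<1+n m)) ⟩
  sumToℕ m (λ i → (m C i) * F (suc i)) + (sumToℕ m (λ i → (m C i) * F i) + 0)
    ≡⟨ cong₂ _+_ refl (trans (+-identityʳ _)
         (sumToℕ-cong m (λ i i≤m → cong (λ k → (m C i) * f i k) (+-∸-assoc 1 i≤m)))) ⟩
  binomialSum m (λ i → f (suc i)) + binomialSum m (λ i k → f i (suc k)) ∎
  where
  open ≡-Reasoning
  F : ℕ → ℕ
  F i = f i (suc m ∸ i)
  pascal : ∀ i → (suc m C suc i) * F (suc i) ≡ (m C i) * F (suc i) + (m C suc i) * F (suc i)
  pascal i = trans (cong (_* F (suc i)) (sym (nCk+nC[k+1]≡[n+1]C[k+1] m i))) (*-distribʳ-+ (F (suc i)) (m C i) (m C suc i))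

sumWords-count : ∀ m f → sumWords m (λ w → f (count true w) (count false w)) ≡ binomialSum m f
sumWords-count zero    f = sym (+-identityʳ (f 0 0))
sumWords-count (suc m) f =
  trans (cong₂ _+_ (sumWords-count m (λ i → f (suc i))) (sumWords-count m (λ i k → f i (suc k))))
        (sym (binomialSum-suc m f))

-- Counting left and right parts

rootCount : ℕ → ℕ → ℕ → ℕ → ℕ
rootCount zero zero zero zero = 1
rootCount _    _    _    _    = 0

leftChildCount : (ℕ → ℕ → Maybe ℕ → Maybe ℕ → ℕ) → ℕ → ℕ → ℕ → ℕ
leftChildCount c (suc i) j (suc a) = c i j (just a) nothing
leftChildCount c _       _ _       = 0

rightChildCount : (ℕ → ℕ → Maybe ℕ → Maybe ℕ → ℕ) → ℕ → ℕ → ℕ → ℕ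
rightChildCount c i (suc j) (suc b) = c i j nothing (just b)
rightChildCount c _ _       _       = 0

leftPartCount : (ℕ → ℕ → Maybe ℕ → Maybe ℕ → ℕ) → ℕ → ℕ → ℕ → ℕ
leftPartCount c i j a = rootCount i j a 0 + leftChildCount c i j a

rightPartCount : (ℕ → ℕ → Maybe ℕ → Maybe ℕ → ℕ) → ℕ → ℕ → ℕ → ℕ
rightPartCount c i j b = rootCount i j 0 b + rightChildCount c i j b

Σ-Maybe↔ : ∀ (P : Maybe A → Set) → Σ (Maybe A) P ↔ (P nothing ⊎ Σ A (P ∘ just))
Σ-Maybe↔ P = mk↔ₛ′
  (λ { (nothing , p) → inj₁ p ; (just x , p) → inj₂ (x , p) })
  (λ { (inj₁ p) → nothing , p ; (inj₂ (x , p)) → just x , p })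
  (λ { (inj₁ _) → refl ; (inj₂ _) → refl })
  (λ { (nothing , _) → refl ; (just _ , _) → refl })

Σ-Vec↔ : ∀ {m} (P : Vec Bool (suc m) → Set) →
         Σ (Vec Bool (suc m)) P ↔ (Σ (Vec Bool m) (P ∘ (true ∷_)) ⊎ Σ (Vec Bool m) (P ∘ (false ∷_)))
Σ-Vec↔ P = mk↔ₛ′
  (λ { (true ∷ w , p) → inj₁ (w , p) ; (false ∷ w , p) → inj₂ (w , p) })
  (λ { (inj₁ (w , p)) → true ∷ w , p ; (inj₂ (w , p)) → false ∷ w , p })
  (λ { (inj₁ _) → refl ; (inj₂ _) → refl })
  (λ { (true ∷ _ , _) → refl ; (false ∷ _ , _) → refl })

¬↔Fin0 : ¬ A → A ↔ Fin 0
¬↔Fin0 ¬a = mk↔ₛ′ (⊥-elim ∘ ¬a) (λ ()) (λ ()) (⊥-elim ∘ ¬a)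

Σ-Vec↔Fin : ∀ m (g : Vec Bool m → ℕ) → Σ (Vec Bool m) (Fin ∘ g) ↔ Fin (sumWords m g)
Σ-Vec↔Fin zero    g = mk↔ₛ′ (λ { ([] , i) → i }) ([] ,_) (λ _ → refl) (λ { ([] , _) → refl })
Σ-Vec↔Fin (suc m) g =
  ↔-trans (Σ-Vec↔ (Fin ∘ g)) (↔-trans (Σ-Vec↔Fin m _ ⊎-↔ Σ-Vec↔Fin m _) (↔-sym +↔⊎))

rootOnly↔Fin : ∀ i j a b → T (selNAT i j (just a) (just b) (node nothing nothing)) ↔ Fin (rootCount i j a b)
rootOnly↔Fin zero    zero    zero    zero    = ↔-sym 1↔⊤
rootOnly↔Fin (suc i) _       _       _       = ↔-sym 0↔⊥
rootOnly↔Fin zero    (suc j) _       _       = ↔-sym 0↔⊥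
rootOnly↔Fin zero    zero    (suc a) _       = ↔-sym 0↔⊥
rootOnly↔Fin zero    zero    zero    (suc b) = ↔-sym 0↔⊥

LeftChild : ℕ → ℕ → ℕ → Set
LeftChild i j a = Σ (ℕ × LTree) λ ks → T (selNAT i j (just a) (just 0) (node (just ks) nothing))

RightChild : ℕ → ℕ → ℕ → Set
RightChild i j b = Σ (ℕ × LTree) λ ks → T (selNAT i j (just 0) (just b) (node nothing (just ks)))

-- The left child of a left part carries the largest left label, so removing the root
-- leaves a non-ambiguous tree.
leftChild↔NATset : ∀ i j a → LeftChild (suc i) j (suc a) ↔ NATset i j (just a) nothing
leftChild↔NATset i j a = mk↔ₛ′ to from (λ _ → Σ-T-≡ refl) from∘to
  where
  module Unpack {k s} (h : T (selNAT (suc i) j (just (suc a)) (just 0) (node (just (k , s)) nothing))) where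
    open Selected (selNAT⇒Selected {suc i} {j} {just (suc a)} {just 0} (node (just (k , s)) nothing) h) public
    ancestryₖ : T (all (_<ᵇ k) (leftLabels s)) × T (ancestorOK s)
    ancestryₖ = T∧⁻ {all (_<ᵇ k) (leftLabels s)} (proj₁ (T∧⁻ {ancL (just (k , s))} ancestry))
    top : k ≡ suc i × Labelling i (leftLabels s)
    top = Labelling-top (Labelling-++[]⁻ leftLabelling) (All.map (<ᵇ⇒< _ _) (all⁺ _ _ (proj₁ ancestryₖ)))

  to : LeftChild (suc i) j (suc a) → NATset i j (just a) nothing
  to ((k , s) , h) = s , Selected⇒selNAT selected
    where
    open Unpack {k} {s} h
    selected : Selected i j (just a) nothing s
    selected = record
      { leftLabelling  = proj₂ top
      ; rightLabelling = Labelling-++[]⁻ rightLabelling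
      ; ancestry       = proj₂ ancestryₖ
      ; leftBranch     = leftBranch
      ; rightBranch    = _ }

  from : NATset i j (just a) nothing → LeftChild (suc i) j (suc a)
  from (s , h) = (suc i , s) , Selected⇒selNAT selected
    where
    open Selected (selNAT⇒Selected {i} {j} {just a} {nothing} s h)
    pushed : Labelling (suc i) (suc i ∷ leftLabels s) × All (_< suc i) (leftLabels s)
    pushed = Labelling-push leftLabelling
    selected : Selected (suc i) j (just (suc a)) (just 0) (node (just (suc i , s)) nothing)
    selected = record
      { leftLabelling  = Labelling-++[]⁺ (proj₁ pushed)
      ; rightLabelling = Labelling-++[]⁺ rightLabelling
      ; ancestry       = T∧⁺ (T∧⁺ (all⁻ _ (All.map <⇒<ᵇ (proj₂ pushed))) ancestry) _
      ; leftBranch     = leftBranch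
      ; rightBranch    = _ }

  from∘to : ∀ x → from (to x) ≡ x
  from∘to ((k , s) , h) = Σ-T-≡ (cong (_, s) (sym (proj₁ (Unpack.top {k} {s} h))))

rightChild↔NATset : ∀ i j b → RightChild i (suc j) (suc b) ↔ NATset i j nothing (just b)
rightChild↔NATset i j b = mk↔ₛ′ to from (λ _ → Σ-T-≡ refl) from∘to
  where
  module Unpack {k s} (h : T (selNAT i (suc j) (just 0) (just (suc b)) (node nothing (just (k , s))))) where
    open Selected (selNAT⇒Selected {i} {suc j} {just 0} {just (suc b)} (node nothing (just (k , s))) h) public
    ancestryₖ : T (all (_<ᵇ k) (rightLabels s)) × T (ancestorOK s)
    ancestryₖ = T∧⁻ {all (_<ᵇ k) (rightLabels s)} ancestry
    top : k ≡ suc j × Labelling j (rightLabels s)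
    top = Labelling-top rightLabelling (All.map (<ᵇ⇒< _ _) (all⁺ _ _ (proj₁ ancestryₖ)))

  to : RightChild i (suc j) (suc b) → NATset i j nothing (just b)
  to ((k , s) , h) = s , Selected⇒selNAT selected
    where
    open Unpack {k} {s} h
    selected : Selected i j nothing (just b) s
    selected = record
      { leftLabelling  = leftLabelling
      ; rightLabelling = proj₂ top
      ; ancestry       = proj₂ ancestryₖ
      ; leftBranch     = _
      ; rightBranch    = rightBranch }

  from : NATset i j nothing (just b) → RightChild i (suc j) (suc b)
  from (s , h) = (suc j , s) , Selected⇒selNAT selected
    where
    open Selected (selNAT⇒Selected {i} {j} {nothing} {just b} s h)
    pushed : Labelling (suc j) (suc j ∷ rightLabels s) × All (_< suc j) (rightLabels s)
    pushed = Labelling-push rightLabelling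
    selected : Selected i (suc j) (just 0) (just (suc b)) (node nothing (just (suc j , s)))
    selected = record
      { leftLabelling  = leftLabelling
      ; rightLabelling = proj₁ pushed
      ; ancestry       = T∧⁺ (all⁻ _ (All.map <⇒<ᵇ (proj₂ pushed))) ancestry
      ; leftBranch     = _
      ; rightBranch    = rightBranch }

  from∘to : ∀ x → from (to x) ≡ x
  from∘to ((k , s) , h) = Σ-T-≡ (cong (_, s) (sym (proj₁ (Unpack.top {k} {s} h))))

module _ {c : ℕ → ℕ → Maybe ℕ → Maybe ℕ → ℕ} (c-counts : IsCount c) where

  leftChild↔Fin : ∀ i j a → LeftChild i j a ↔ Fin (leftChildCount c i j a)
  leftChild↔Fin zero    j a       = ¬↔Fin0 λ ((k , s) , h) →
    case Labelling.length≡ (Selected.leftLabelling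
           (selNAT⇒Selected {0} {j} {just a} {just 0} (node (just (k , s)) nothing) h)) of λ ()
  leftChild↔Fin (suc i) j zero    = ¬↔Fin0 λ ((k , s) , h) →
    Selected.leftBranch (selNAT⇒Selected {suc i} {j} {just 0} {just 0} (node (just (k , s)) nothing) h)
  leftChild↔Fin (suc i) j (suc a) = ↔-trans (leftChild↔NATset i j a) (↔-sym (c-counts i j (just a) nothing))

  rightChild↔Fin : ∀ i j b → RightChild i j b ↔ Fin (rightChildCount c i j b)
  rightChild↔Fin i zero    b       = ¬↔Fin0 λ ((k , s) , h) →
    case Labelling.length≡ (Selected.rightLabelling
           (selNAT⇒Selected {i} {0} {just 0} {just b} (node nothing (just (k , s))) h)) of λ ()
  rightChild↔Fin i (suc j) zero    = ¬↔Fin0 λ ((k , s) , h) →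
    Selected.rightBranch (selNAT⇒Selected {i} {suc j} {just 0} {just 0} (node nothing (just (k , s))) h)
  rightChild↔Fin i (suc j) (suc b) = ↔-trans (rightChild↔NATset i j b) (↔-sym (c-counts i j nothing (just b)))

  LeftPart↔Fin : ∀ i j a → LeftPart i j a ↔ Fin (leftPartCount c i j a)
  LeftPart↔Fin i j a =
    ↔-trans (Σ-Maybe↔ _) (↔-trans (rootOnly↔Fin i j a 0 ⊎-↔ leftChild↔Fin i j a) (↔-sym +↔⊎))

  RightPart↔Fin : ∀ i j b → RightPart i j b ↔ Fin (rightPartCount c i j b)
  RightPart↔Fin i j b =
    ↔-trans (Σ-Maybe↔ _) (↔-trans (rootOnly↔Fin i j 0 b ⊎-↔ rightChild↔Fin i j b) (↔-sym +↔⊎))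

  Decomposition↔Fin : ∀ m n a b → Decomposition m n a b ↔
    Fin (sumWords m λ w → sumWords n λ v →
           leftPartCount c (count true w) (count true v) a * rightPartCount c (count false w) (count false v) b)
  Decomposition↔Fin m n a b =
    ↔-trans (Σ-↔ ↔-refl λ {w} →
      ↔-trans (Σ-↔ ↔-refl λ {v} →
        ↔-trans (LeftPart↔Fin (count true w) (count true v) a ×-↔ RightPart↔Fin (count false w) (count false v) b)
                (↔-sym *↔×))
      (Σ-Vec↔Fin n _))
    (Σ-Vec↔Fin m _)

  count-binomial : ∀ m n a b →
    c m n (just a) (just b) ≡
    sumToℕ m λ i → sumToℕ n λ j → (m C i) * ((n C j) * (leftPartCount c i j a * rightPartCount c (m ∸ i) (n ∸ j) b))
  count-binomial m n a b = begin
    c m n (just a) (just b)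
      ≡⟨ ↔⇒≡ (↔-trans (c-counts m n (just a) (just b)) (↔-trans (NATset↔Decomposition {m} {n} {a} {b}) (Decomposition↔Fin m n a b))) ⟩
    sumWords m (λ w → sumWords n λ v → L (count true w) (count true v) * R (count false w) (count false v))
      ≡⟨ sumWords-cong m (λ w → sumWords-count n (λ j j′ → L (count true w) j * R (count false w) j′)) ⟩
    sumWords m (λ w → binomialSum n λ j j′ → L (count true w) j * R (count false w) j′)
      ≡⟨ sumWords-count m (λ i i′ → binomialSum n λ j j′ → L i j * R i′ j′) ⟩
    binomialSum m (λ i i′ → binomialSum n λ j j′ → L i j * R i′ j′)
      ≡⟨ sumToℕ-cong m (λ i _ → *-distribˡ-sumToℕ n (m C i) _) ⟩
    sumToℕ m (λ i → sumToℕ n λ j → (m C i) * ((n C j) * (L i j * R (m ∸ i) (n ∸ j)))) ∎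
    where
    open ≡-Reasoning
    L R : ℕ → ℕ → ℕ
    L i j = leftPartCount c i j a
    R i j = rightPartCount c i j b

private
  toℚᵘ-/ : ∀ p d .{{_ : NonZero d}} → toℚᵘ (p ℚ./ d) ℚᵘ.≃ mkℚᵘ p (pred d)
  toℚᵘ-/ p (suc d) = toℚᵘ-fromℚᵘ (mkℚᵘ p d)

/-cross : ∀ p q d e .{{_ : NonZero d}} .{{_ : NonZero e}} → p * e ≡ q * d → (ℤ.+ p) ℚ./ d ≡ (ℤ.+ q) ℚ./ e
/-cross p q (suc d) (suc e) eq = toℚᵘ-injective
  (ℚᵘ.≃-trans (toℚᵘ-/ (ℤ.+ p) (suc d)) (ℚᵘ.≃-trans (ℚᵘ.*≡* cross) (ℚᵘ.≃-sym (toℚᵘ-/ (ℤ.+ q) (suc e)))))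
  where
  cross : ℤ.+ p ℤ.* ℤ.+ suc e ≡ ℤ.+ q ℤ.* ℤ.+ suc d
  cross = trans (sym (ℤ.pos-* p (suc e))) (trans (cong ℤ.+_ eq) (ℤ.pos-* q (suc d)))

/-* : ∀ p q d e .{{_ : NonZero d}} .{{_ : NonZero e}} →
      ((ℤ.+ p) ℚ./ d) ℚ.* ((ℤ.+ q) ℚ./ e) ≡ ((ℤ.+ (p * q)) ℚ./ (d * e)) {{m*n≢0 d e}}
/-* p q (suc d) (suc e) = toℚᵘ-injective
  (ℚᵘ.≃-trans (toℚᵘ-homo-* ((ℤ.+ p) ℚ./ suc d) ((ℤ.+ q) ℚ./ suc e))
  (ℚᵘ.≃-trans (ℚᵘ.*-cong (toℚᵘ-/ (ℤ.+ p) (suc d)) (toℚᵘ-/ (ℤ.+ q) (suc e)))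
  (ℚᵘ.≃-trans (ℚᵘ.*≡* (cong (ℤ._* ℤ.+ (suc d * suc e)) (sym (ℤ.pos-* p q))))
              (ℚᵘ.≃-sym (toℚᵘ-/ (ℤ.+ (p * q)) (suc d * suc e))))))

/-+ : ∀ p q d .{{_ : NonZero d}} → ((ℤ.+ p) ℚ./ d) ℚ.+ ((ℤ.+ q) ℚ./ d) ≡ (ℤ.+ (p + q)) ℚ./ d
/-+ p q (suc d) = toℚᵘ-injective
  (ℚᵘ.≃-trans (toℚᵘ-homo-+ ((ℤ.+ p) ℚ./ suc d) ((ℤ.+ q) ℚ./ suc d))
  (ℚᵘ.≃-trans (ℚᵘ.+-cong (toℚᵘ-/ (ℤ.+ p) (suc d)) (toℚᵘ-/ (ℤ.+ q) (suc d)))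
  (ℚᵘ.≃-trans (ℚᵘ.*≡* cross) (ℚᵘ.≃-sym (toℚᵘ-/ (ℤ.+ (p + q)) (suc d))))))
  where
  D : ℕ
  D = suc d
  cross : (ℤ.+ p ℤ.* ℤ.+ D ℤ.+ ℤ.+ q ℤ.* ℤ.+ D) ℤ.* ℤ.+ D ≡ ℤ.+ (p + q) ℤ.* ℤ.+ suc (pred (D * D))
  cross = begin
    (ℤ.+ p ℤ.* ℤ.+ D ℤ.+ ℤ.+ q ℤ.* ℤ.+ D) ℤ.* ℤ.+ D ≡⟨ cong (ℤ._* ℤ.+ D) (cong₂ ℤ._+_ (ℤ.pos-* p D) (ℤ.pos-* q D)) ⟨
    (ℤ.+ (p * D) ℤ.+ ℤ.+ (q * D)) ℤ.* ℤ.+ D     ≡⟨ cong (ℤ._* ℤ.+ D) (ℤ.pos-+ (p * D) (q * D)) ⟨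
    ℤ.+ (p * D + q * D) ℤ.* ℤ.+ D             ≡⟨ ℤ.pos-* (p * D + q * D) D ⟨
    ℤ.+ ((p * D + q * D) * D)               ≡⟨ cong ℤ.+_ (trans (cong (_* D) (sym (*-distribʳ-+ D p q))) (*-assoc (p + q) D D)) ⟩
    ℤ.+ ((p + q) * (D * D))                 ≡⟨ ℤ.pos-* (p + q) (D * D) ⟩
    ℤ.+ (p + q) ℤ.* ℤ.+ (D * D)               ∎
    where open ≡-Reasoning

expCoeff-0 : ∀ i j → expCoeff 0 i j ≡ 0ℚ
expCoeff-0 i j = ℚ.0/n≡0 (i ! * j !) {{i !* j !≢0}}

expCoeff-+ : ∀ x y i j → expCoeff (x + y) i j ≡ expCoeff x i j ℚ.+ expCoeff y i j
expCoeff-+ x y i j = sym (/-+ x y (i ! * j !) {{i !* j !≢0}})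

expCoeff-sumToℕ : ∀ k (f : ℕ → ℕ) i j → expCoeff (sumToℕ k f) i j ≡ sumTo k (λ l → expCoeff (f l) i j)
expCoeff-sumToℕ zero    f i j = refl
expCoeff-sumToℕ (suc k) f i j =
  trans (expCoeff-+ (sumToℕ k f) (f (suc k)) i j) (cong (ℚ._+ expCoeff (f (suc k)) i j) (expCoeff-sumToℕ k f i j))

expCoeff-∫x : ∀ x i j → expCoeff x i j ℚ.* ((ℤ.+ 1) ℚ./ suc i) ≡ expCoeff x (suc i) j
expCoeff-∫x x i j = trans (/-* x 1 (i ! * j !) (suc i) {{i !* j !≢0}})
  (/-cross (x * 1) x (i ! * j ! * suc i) (suc i ! * j !) {{m*n≢0 (i ! * j !) (suc i) {{i !* j !≢0}}}} {{suc i !* j !≢0}}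
     (rearrange x (suc i) (i !) (j !)))
  where
  rearrange : ∀ x s f g → (x * 1) * ((s * f) * g) ≡ x * ((f * g) * s)
  rearrange = solve-∀

expCoeff-∫y : ∀ x i j → expCoeff x i j ℚ.* ((ℤ.+ 1) ℚ./ suc j) ≡ expCoeff x i (suc j)
expCoeff-∫y x i j = trans (/-* x 1 (i ! * j !) (suc j) {{i !* j !≢0}})
  (/-cross (x * 1) x (i ! * j ! * suc j) (i ! * suc j !) {{m*n≢0 (i ! * j !) (suc j) {{i !* j !≢0}}}} {{i !* suc j !≢0}}
     (rearrange x (suc j) (i !) (j !)))
  where
  rearrange : ∀ x s f g → (x * 1) * (f * (s * g)) ≡ x * ((f * g) * s)
  rearrange = solve-∀

binomial-factorial : ∀ {m i} → i ≤ m → (m C i) * (i ! * (m ∸ i) !) ≡ m !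
binomial-factorial {m} {i} i≤m = trans (cong (_* (i ! * (m ∸ i) !)) (nCk≡n!/k![n-k]! i≤m)) (m/n*n≡m (k![n∸k]!∣n! i≤m))
  where instance _ = i !* (m ∸ i) !≢0

expCoeff-binomial : ∀ {m n i j} x y → i ≤ m → j ≤ n →
  expCoeff x i j ℚ.* expCoeff y (m ∸ i) (n ∸ j) ≡ expCoeff ((m C i) * ((n C j) * (x * y))) m n
expCoeff-binomial {m} {n} {i} {j} x y i≤m j≤n =
  trans (/-* x y (i ! * j !) ((m ∸ i) ! * (n ∸ j) !))
        (/-cross (x * y) ((m C i) * ((n C j) * (x * y))) ((i ! * j !) * ((m ∸ i) ! * (n ∸ j) !)) (m ! * n !) cross)
  where
  instance
    _ = i !* j !≢0
    _ = (m ∸ i) !* (n ∸ j) !≢0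
    _ = m !* n !≢0
    _ = m*n≢0 (i ! * j !) ((m ∸ i) ! * (n ∸ j) !)
  rearrange : ∀ xy b₁ b₂ f₁ f₂ g₁ g₂ →
    xy * ((b₁ * (f₁ * g₁)) * (b₂ * (f₂ * g₂))) ≡ (b₁ * (b₂ * xy)) * ((f₁ * f₂) * (g₁ * g₂))
  rearrange = solve-∀
  cross : (x * y) * (m ! * n !) ≡ ((m C i) * ((n C j) * (x * y))) * ((i ! * j !) * ((m ∸ i) ! * (n ∸ j) !))
  cross = trans (cong₂ (λ M N → (x * y) * (M * N)) (sym (binomial-factorial i≤m)) (sym (binomial-factorial j≤n)))
                (rearrange (x * y) (m C i) (n C j) (i !) (j !) ((m ∸ i) !) ((n ∸ j) !))

sumTo-cong : ∀ m {f g : ℕ → ℚ} → (∀ i → i ≤ m → f i ≡ g i) → sumTo m f ≡ sumTo m g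
sumTo-cong zero    f≡g = f≡g 0 z≤n
sumTo-cong (suc m) f≡g = cong₂ ℚ._+_ (sumTo-cong m (λ i i≤m → f≡g i (m≤n⇒m≤1+n i≤m))) (f≡g (suc m) ≤-refl)

sumTo-head : ∀ m (f : ℕ → ℚ) → (∀ i → f (suc i) ≡ 0ℚ) → sumTo m f ≡ f 0
sumTo-head zero    f _    = refl
sumTo-head (suc m) f tail = trans (cong₂ ℚ._+_ (sumTo-head m f tail) (tail m)) (ℚ.+-identityʳ (f 0))

sumTo-last : ∀ m (f : ℕ → ℚ) → (∀ i → i < m → f i ≡ 0ℚ) → sumTo m f ≡ f m
sumTo-last zero    f _    = refl
sumTo-last (suc m) f init =
  trans (cong (ℚ._+ f (suc m)) (trans (sumTo-last m f (λ i i<m → init i (m<n⇒m<1+n i<m))) (init m ≤-refl)))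
        (ℚ.+-identityˡ (f (suc m)))

-‿≡∸ : ∀ m n → m - n ≡ m ∸ n
-‿≡∸ m       zero    = refl
-‿≡∸ zero    (suc n) = refl
-‿≡∸ (suc m) (suc n) = -‿≡∸ m n

m<n⇒n∸m≡1+[n∸1+m] : ∀ {m n} → m < n → n ∸ m ≡ suc (n ∸ suc m)
m<n⇒n∸m≡1+[n∸1+m] {zero}  {suc n} _         = refl
m<n⇒n∸m≡1+[n∸1+m] {suc m} {suc n} (s≤s m<n) = m<n⇒n∸m≡1+[n∸1+m] m<n

⊗-collapse : ∀ (f g : PS) → (∀ i j k l → f i j k (suc l) ≡ 0ℚ) → (∀ i j k l → g i j (suc k) l ≡ 0ℚ) →
             ∀ m n a b → (f ⊗ g) m n a b ≡ sumTo m λ i → sumTo n λ j → f i j a 0 ℚ.* g (m ∸ i) (n ∸ j) 0 b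
⊗-collapse f g f-β-free g-α-free m n a b = sumTo-cong m λ i _ → sumTo-cong n λ j _ → begin
  sumTo a (λ k → sumTo b λ l → f i j k l ℚ.* g (m - i) (n - j) (a - k) (b - l))
    ≡⟨ sumTo-cong a (λ k _ → sumTo-head b _ (λ l → trans (cong (ℚ._* g (m - i) (n - j) (a - k) (b - suc l)) (f-β-free i j k l))
                                                  (ℚ.*-zeroˡ (g (m - i) (n - j) (a - k) (b - suc l))))) ⟩
  sumTo a (λ k → f i j k 0 ℚ.* g (m - i) (n - j) (a - k) b)
    ≡⟨ sumTo-last a _ (λ k k<a → trans (cong (λ d → f i j k 0 ℚ.* g (m - i) (n - j) d b) (-‿≡∸ a k))
                                 (trans (cong (λ d → f i j k 0 ℚ.* g (m - i) (n - j) d b) (m<n⇒n∸m≡1+[n∸1+m] k<a))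
                                 (trans (cong (f i j k 0 ℚ.*_) (g-α-free _ _ _ b)) (ℚ.*-zeroʳ (f i j k 0))))) ⟩
  f i j a 0 ℚ.* g (m - i) (n - j) (a - a) b
    ≡⟨ cong₂ (λ m′ n′ → f i j a 0 ℚ.* g m′ n′ (a - a) b) (-‿≡∸ m i) (-‿≡∸ n j) ⟩
  f i j a 0 ℚ.* g (m ∸ i) (n ∸ j) (a - a) b
    ≡⟨ cong (λ d → f i j a 0 ℚ.* g (m ∸ i) (n ∸ j) d b) (trans (-‿≡∸ a a) (n∸n≡0 a)) ⟩
  f i j a 0 ℚ.* g (m ∸ i) (n ∸ j) 0 b ∎
  where open ≡-Reasoning

oneS-coeff : ∀ i j a b → oneS i j a b ≡ expCoeff (rootCount i j a b) i j
oneS-coeff zero    zero    zero    zero    = refl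
oneS-coeff (suc i) j       _       _       = sym (expCoeff-0 (suc i) j)
oneS-coeff zero    (suc j) _       _       = sym (expCoeff-0 0 (suc j))
oneS-coeff zero    zero    (suc a) _       = sym (expCoeff-0 0 0)
oneS-coeff zero    zero    zero    (suc b) = sym (expCoeff-0 0 0)

oneS-β-free : ∀ i j k l → oneS i j k (suc l) ≡ 0ℚ
oneS-β-free zero    zero    zero    l = refl
oneS-β-free zero    zero    (suc k) l = refl
oneS-β-free zero    (suc j) k       l = refl
oneS-β-free (suc i) j       k       l = refl

oneS-α-free : ∀ i j k l → oneS i j (suc k) l ≡ 0ℚ
oneS-α-free zero    zero    k l = refl
oneS-α-free zero    (suc j) k l = refl
oneS-α-free (suc i) j       k l = refl

module _ (c : ℕ → ℕ → Maybe ℕ → Maybe ℕ → ℕ) where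

  α∫Gα1-coeff : ∀ i j a → α· (∫x (Gα1 c)) i j a 0 ≡ expCoeff (leftChildCount c i j a) i j
  α∫Gα1-coeff zero    j zero    = sym (expCoeff-0 0 j)
  α∫Gα1-coeff (suc i) j zero    = sym (expCoeff-0 (suc i) j)
  α∫Gα1-coeff zero    j (suc a) = sym (expCoeff-0 0 j)
  α∫Gα1-coeff (suc i) j (suc a) = expCoeff-∫x (c i j (just a) nothing) i j

  β∫G1β-coeff : ∀ i j b → β· (∫y (G1β c)) i j 0 b ≡ expCoeff (rightChildCount c i j b) i j
  β∫G1β-coeff i zero    zero    = sym (expCoeff-0 i 0)
  β∫G1β-coeff i (suc j) zero    = sym (expCoeff-0 i (suc j))
  β∫G1β-coeff i zero    (suc b) = sym (expCoeff-0 i 0)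
  β∫G1β-coeff i (suc j) (suc b) = expCoeff-∫y (c i j nothing (just b)) i j

  α∫Gα1-β-free : ∀ i j k l → α· (∫x (Gα1 c)) i j k (suc l) ≡ 0ℚ
  α∫Gα1-β-free i       j zero    l = refl
  α∫Gα1-β-free zero    j (suc k) l = refl
  α∫Gα1-β-free (suc i) j (suc k) l = ℚ.*-zeroˡ ((ℤ.+ 1) ℚ./ suc i)

  β∫G1β-α-free : ∀ i j k l → β· (∫y (G1β c)) i j (suc k) l ≡ 0ℚ
  β∫G1β-α-free i zero    k zero    = refl
  β∫G1β-α-free i (suc j) k zero    = refl
  β∫G1β-α-free i zero    k (suc l) = refl
  β∫G1β-α-free i (suc j) k (suc l) = ℚ.*-zeroˡ ((ℤ.+ 1) ℚ./ suc j)

  leftSeries : PS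
  leftSeries = oneS ⊕ α· (∫x (Gα1 c))

  rightSeries : PS
  rightSeries = oneS ⊕ β· (∫y (G1β c))

  leftSeries-coeff : ∀ i j a → leftSeries i j a 0 ≡ expCoeff (leftPartCount c i j a) i j
  leftSeries-coeff i j a = trans (cong₂ ℚ._+_ (oneS-coeff i j a 0) (α∫Gα1-coeff i j a))
                                 (sym (expCoeff-+ (rootCount i j a 0) _ i j))

  rightSeries-coeff : ∀ i j b → rightSeries i j 0 b ≡ expCoeff (rightPartCount c i j b) i j
  rightSeries-coeff i j b = trans (cong₂ ℚ._+_ (oneS-coeff i j 0 b) (β∫G1β-coeff i j b))
                                  (sym (expCoeff-+ (rootCount i j 0 b) _ i j))

  leftSeries-β-free : ∀ i j k l → leftSeries i j k (suc l) ≡ 0ℚ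
  leftSeries-β-free i j k l =
    trans (cong₂ ℚ._+_ (oneS-β-free i j k l) (α∫Gα1-β-free i j k l)) (ℚ.+-identityʳ 0ℚ)

  rightSeries-α-free : ∀ i j k l → rightSeries i j (suc k) l ≡ 0ℚ
  rightSeries-α-free i j k l =
    trans (cong₂ ℚ._+_ (oneS-α-free i j k l) (β∫G1β-α-free i j k l)) (ℚ.+-identityʳ 0ℚ)

mainTheorem3 : (c : ℕ → ℕ → Maybe ℕ → Maybe ℕ → ℕ) → IsCount c →
    ∀ m n a b →
    Gαβ c m n a b ≡ ((oneS ⊕ α· (∫x (Gα1 c))) ⊗ (oneS ⊕ β· (∫y (G1β c)))) m n a b
mainTheorem3 c c-counts m n a b = begin
  expCoeff (c m n (just a) (just b)) m n
    ≡⟨ cong (λ x → expCoeff x m n) (count-binomial c-counts m n a b) ⟩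
  expCoeff (sumToℕ m λ i → sumToℕ n λ j → (m C i) * ((n C j) * (L i j * R (m ∸ i) (n ∸ j)))) m n
    ≡⟨ trans (expCoeff-sumToℕ m _ m n) (sumTo-cong m λ i _ → expCoeff-sumToℕ n _ m n) ⟩
  (sumTo m λ i → sumTo n λ j → expCoeff ((m C i) * ((n C j) * (L i j * R (m ∸ i) (n ∸ j)))) m n)
    ≡⟨ sumTo-cong m (λ i i≤m → sumTo-cong n λ j j≤n → sym (expCoeff-binomial (L i j) _ i≤m j≤n)) ⟩
  (sumTo m λ i → sumTo n λ j → expCoeff (L i j) i j ℚ.* expCoeff (R (m ∸ i) (n ∸ j)) (m ∸ i) (n ∸ j))
    ≡⟨ sumTo-cong m (λ i _ → sumTo-cong n λ j _ →
         sym (cong₂ ℚ._*_ (leftSeries-coeff c i j a) (rightSeries-coeff c (m ∸ i) (n ∸ j) b))) ⟩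
  (sumTo m λ i → sumTo n λ j → leftSeries c i j a 0 ℚ.* rightSeries c (m ∸ i) (n ∸ j) 0 b)
    ≡⟨ ⊗-collapse (leftSeries c) (rightSeries c) (leftSeries-β-free c) (rightSeries-α-free c) m n a b ⟨
  (leftSeries c ⊗ rightSeries c) m n a b ∎
  where
  open ≡-Reasoning
  L R : ℕ → ℕ → ℕ
  L i j = leftPartCount c i j a
  R i j = rightPartCount c i j b
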